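{- Let $(n,k)\in\mathbb{N}^2$ with $0\le k\le n$, $n\ne 2k$, and $n$ or $k$ odd. If $\varphi$ is an automorphism of $\mathcal{J}(n,k)$ such that $\varphi\circ\varphi$ is the identity and $\{u,\varphi(u)\}$ is not an edge of $\mathcal{J}(n,k)$ for every vertex $u$, then $\varphi$ is the identity.
   Context: The Johnson graph $\mathcal{J}(n,k)$ has as vertices the $k$-element subsets of an $n$-element set, two vertices adjacent iff the sets intersect in exactly $k-1$ elements. -}

module Defs where

open import Data.Nat using (ℕ; suc)
open import Data.Product using (Σ; _×_; proj₁)
open import Data.Fin.Subset using (Subset; ∣_∣; _∩_)
open import Relation.Binary.PropositionalEquality using (_≡_)

Vertex : ℕ → ℕ → Set
Vertex n k = Σ (Subset n) (λ s → ∣ s ∣ ≡ k)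

-- Adjacency: the two sets intersect in exactly k-1 elements
-- (written  1 + |u ∩ v| = k  to avoid truncated subtraction; for k = 0 there are no edges).
Adjacent : ∀ {n k} → Vertex n k → Vertex n k → Set
Adjacent {n} {k} u v = suc ∣ proj₁ u ∩ proj₁ v ∣ ≡ k

_≈V_ : ∀ {n k} → Vertex n k → Vertex n k → Set
u ≈V v = proj₁ u ≡ proj₁ v

record Automorphism (n k : ℕ) : Set where
  field
    fun     : Vertex n k → Vertex n k
    inv     : Vertex n k → Vertex n k
    invˡ    : ∀ u → fun (inv u) ≈V u
    invʳ    : ∀ u → inv (fun u) ≈V u
    adj-iff : ∀ u v → (Adjacent u v → Adjacent (fun u) (fun v)) × (Adjacent (fun u) (fun v) → Adjacent u v)

-- The neighbours of a vertex u are the sets u − a + b with a ∈ u and b ∉ u; two of them are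
-- adjacent iff they share exactly one of a and b, so the neighbourhood of u is the rook's graph
-- on the grid u × ∁u. An automorphism φ restricts to an isomorphism from the neighbourhood of u
-- onto that of φ u, and such an isomorphism maps rows to rows: a row sent into a column would
-- give n − k ≤ k by injectivity, the inverse would give k ≤ n − k, and n ≠ 2k.
--
-- If φ fixes u, the grid map is an involution moving no cell within its row or column, since
-- φ w is never adjacent to w. A moved cell would make the induced maps on rows and on columns
-- fixed-point-free involutions, so k and n − k would both be even. Hence φ fixes the neighbours
-- of a fixed vertex, and by connectivity every vertex.
--
-- A fixed vertex exists: |u ∩ φ u| = k − 1 is excluded, and if |u ∩ φ u| ≤ k − 2, exchanging an
-- element of u ∖ φ u for one of two elements of φ u ∖ u gives a neighbour w with a larger
-- |w ∩ φ w|.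

module Submission where

open import Axiom.UniquenessOfIdentityProofs using (module Decidable⇒UIP)
open import Data.Bool using (Bool; true; false; _∧_; not)
import Data.Bool.Properties as Boolₚ
open import Data.Empty using (⊥; ⊥-elim)
open import Data.Fin using (Fin; zero; suc)
open import Data.Fin.Properties using (_≟_)
open import Data.Fin.Subset using (Subset; ∣_∣; _∩_; ∁)
open import Data.Fin.Subset.Properties using (∣p∣≤n; ∣∁p∣≡n∸∣p∣; ∩-comm; ∩-idem; ∣p∩q∣≤∣p∣)
open import Data.Nat using (ℕ; zero; suc; _+_; _*_; _∸_; _%_; _≤_; _<_; z≤n; s≤s)
open import Data.Nat.Divisibility using (_∣_; divides; ∣-refl; ∣m∣n⇒∣m+n; n∣m⇒m%n≡0)
open import Data.Nat.Properties
  using ( +-assoc; +-comm; +-identityʳ; +-suc; +-cancelˡ-≡; +-cancelʳ-≡; +-cancelˡ-≤; +-monoˡ-≤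
        ; suc-injective; 0≢1+n; ≡-irrelevant; m+[n∸m]≡n; m≤n+m; m<m+n; n<1+n; m<n⇒0<n∸m
        ; m≤n⇒m<n∨m≡n; ∸-monoʳ-<; ≤-refl; ≤-reflexive; ≤-trans; ≤-antisym; ≤-pred; <-≤-trans; <⇒≱
        ; module ≤-Reasoning )
open import Data.Product using (Σ; ∃; _×_; _,_; proj₁; proj₂)
open import Data.Sum using (_⊎_; inj₁; inj₂; [_,_])
open import Data.Vec using ([]; _∷_; lookup; _[_]≔_)
open import Data.Vec.Properties using (lookup∘update; lookup∘update′; lookup-zipWith; lookup-map)
open import Defs
open import Function using (_∘_; _⇔_; mk⇔; Equivalence)
open import Function.Construct.Composition using (_⇔-∘_)
open import Relation.Binary.PropositionalEquality
  using (_≡_; _≢_; refl; sym; trans; cong; cong₂; subst; subst₂; module ≡-Reasoning)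
open import Relation.Nullary using (¬_; yes; no)

≤⇒≡⊎1+≡⊎2+≤ : ∀ {x y} → x ≤ y → x ≡ y ⊎ suc x ≡ y ⊎ x + 2 ≤ y
≤⇒≡⊎1+≡⊎2+≤ {x} {y} x≤y with m≤n⇒m<n∨m≡n x≤y
... | inj₂ x≡y = inj₁ x≡y
... | inj₁ x<y with m≤n⇒m<n∨m≡n x<y
...   | inj₂ 1+x≡y = inj₂ (inj₁ 1+x≡y)
...   | inj₁ 1+x<y = inj₂ (inj₂ (subst (_≤ y) (+-comm 2 x) 1+x<y))

-- Finite subsets

toℕ : Bool → ℕ
toℕ true  = 1
toℕ false = 0

toℕ-balance : ∀ {a b m m′} → toℕ a + m ≡ toℕ b + m′ → m ≡ m′ ⇔ a ≡ b
toℕ-balance {a} {b} eq = mk⇔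
  (λ m≡m′ → toℕ-injective (+-cancelʳ-≡ _ _ _ (trans eq (cong (toℕ b +_) (sym m≡m′)))))
  (λ { refl → +-cancelˡ-≡ (toℕ a) _ _ eq })
  where
  toℕ-injective : ∀ {a b} → toℕ a ≡ toℕ b → a ≡ b
  toℕ-injective {true}  {true}  _ = refl
  toℕ-injective {false} {false} _ = refl

bool-irrelevant : {a b : Bool} (p q : a ≡ b) → p ≡ q
bool-irrelevant = Decidable⇒UIP.≡-irrelevant Boolₚ._≟_

true≢false : ∀ {a : Bool} → a ≡ true → a ≡ false → ⊥
true≢false refl ()

lookup-∩ : ∀ {n} (s t : Subset n) x → lookup (s ∩ t) x ≡ lookup s x ∧ lookup t x
lookup-∩ s t x = lookup-zipWith _∧_ x s t

∩-true : ∀ {n} (s t : Subset n) x → lookup (s ∩ t) x ≡ true → lookup s x ≡ true × lookup t x ≡ true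
∩-true s t x x∈s∩t = ∧-true (trans (sym (lookup-∩ s t x)) x∈s∩t)
  where
  ∧-true : ∀ {a b} → a ∧ b ≡ true → a ≡ true × b ≡ true
  ∧-true {true} {true} _ = refl , refl

lookup-∁ : ∀ {n} (s : Subset n) x → lookup (∁ s) x ≡ not (lookup s x)
lookup-∁ s x = lookup-map x not s

∁-true⇒false : ∀ {n} (s : Subset n) x → lookup (∁ s) x ≡ true → lookup s x ≡ false
∁-true⇒false s x x∈∁s =
  trans (sym (Boolₚ.not-involutive _)) (cong not (trans (sym (lookup-∁ s x)) x∈∁s))

false⇒∁-true : ∀ {n} (s : Subset n) x → lookup s x ≡ false → lookup (∁ s) x ≡ true
false⇒∁-true s x x∉s = trans (lookup-∁ s x) (cong not x∉s)

∣[]≔∣ : ∀ {n} (s : Subset n) x β → toℕ (lookup s x) + ∣ s [ x ]≔ β ∣ ≡ toℕ β + ∣ s ∣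
∣[]≔∣ (true  ∷ s) zero true  = refl
∣[]≔∣ (true  ∷ s) zero false = refl
∣[]≔∣ (false ∷ s) zero true  = refl
∣[]≔∣ (false ∷ s) zero false = refl
∣[]≔∣ (true  ∷ s) (suc x) β = begin
  toℕ (lookup s x) + suc ∣ s [ x ]≔ β ∣  ≡⟨ +-suc _ _ ⟩
  suc (toℕ (lookup s x) + ∣ s [ x ]≔ β ∣) ≡⟨ cong suc (∣[]≔∣ s x β) ⟩
  suc (toℕ β + ∣ s ∣)                     ≡⟨ +-suc _ _ ⟨
  toℕ β + suc ∣ s ∣                       ∎
  where open ≡-Reasoning
∣[]≔∣ (false ∷ s) (suc x) β = ∣[]≔∣ s x β

[]≔-∩ : ∀ {n} (s t : Subset n) x β → (s [ x ]≔ β) ∩ t ≡ (s ∩ t) [ x ]≔ (β ∧ lookup t x)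
[]≔-∩ (a ∷ s) (b ∷ t) zero    β = refl
[]≔-∩ (a ∷ s) (b ∷ t) (suc x) β = cong (a ∧ b ∷_) ([]≔-∩ s t x β)

∣[]≔-∩∣ : ∀ {n} (s t : Subset n) x β →
          toℕ (lookup (s ∩ t) x) + ∣ (s [ x ]≔ β) ∩ t ∣ ≡ toℕ (β ∧ lookup t x) + ∣ s ∩ t ∣
∣[]≔-∩∣ s t x β = trans (cong (λ r → _ + ∣ r ∣) ([]≔-∩ s t x β)) (∣[]≔∣ (s ∩ t) x _)

∣s∣≡∣s∩t∣+∣s∩∁t∣ : ∀ {n} (s t : Subset n) → ∣ s ∣ ≡ ∣ s ∩ t ∣ + ∣ s ∩ ∁ t ∣
∣s∣≡∣s∩t∣+∣s∩∁t∣ []          []          = refl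
∣s∣≡∣s∩t∣+∣s∩∁t∣ (true  ∷ s) (true  ∷ t) = cong suc (∣s∣≡∣s∩t∣+∣s∩∁t∣ s t)
∣s∣≡∣s∩t∣+∣s∩∁t∣ (true  ∷ s) (false ∷ t) = trans (cong suc (∣s∣≡∣s∩t∣+∣s∩∁t∣ s t)) (sym (+-suc _ _))
∣s∣≡∣s∩t∣+∣s∩∁t∣ (false ∷ s) (_     ∷ t) = ∣s∣≡∣s∩t∣+∣s∩∁t∣ s t

∣s∣+∣∁s∣≡n : ∀ {n} (s : Subset n) → ∣ s ∣ + ∣ ∁ s ∣ ≡ n
∣s∣+∣∁s∣≡n s = trans (cong (∣ s ∣ +_) (∣∁p∣≡n∸∣p∣ s)) (m+[n∸m]≡n (∣p∣≤n s))

differences-empty⇒≡ : ∀ {n} (s t : Subset n) → ∣ s ∩ ∁ t ∣ ≡ 0 → ∣ t ∩ ∁ s ∣ ≡ 0 → s ≡ t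
differences-empty⇒≡ []          []          _ _ = refl
differences-empty⇒≡ (true  ∷ s) (true  ∷ t) p q = cong (true ∷_) (differences-empty⇒≡ s t p q)
differences-empty⇒≡ (false ∷ s) (false ∷ t) p q = cong (false ∷_) (differences-empty⇒≡ s t p q)

∣∩∣≡size⇒≡ : ∀ {n k} (s t : Subset n) → ∣ s ∣ ≡ k → ∣ t ∣ ≡ k → ∣ s ∩ t ∣ ≡ k → s ≡ t
∣∩∣≡size⇒≡ {k = k} s t ∣s∣≡k ∣t∣≡k ∣s∩t∣≡k =
  differences-empty⇒≡ s t (rest-empty s t ∣s∣≡k ∣s∩t∣≡k)
    (rest-empty t s ∣t∣≡k (trans (cong ∣_∣ (∩-comm t s)) ∣s∩t∣≡k))
  where
  rest-empty : ∀ s t → ∣ s ∣ ≡ k → ∣ s ∩ t ∣ ≡ k → ∣ s ∩ ∁ t ∣ ≡ 0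
  rest-empty s t ∣s∣≡k ∣s∩t∣≡k = +-cancelˡ-≡ k _ _ (begin
    k + ∣ s ∩ ∁ t ∣             ≡⟨ cong (_+ ∣ s ∩ ∁ t ∣) ∣s∩t∣≡k ⟨
    ∣ s ∩ t ∣ + ∣ s ∩ ∁ t ∣     ≡⟨ ∣s∣≡∣s∩t∣+∣s∩∁t∣ s t ⟨
    ∣ s ∣                       ≡⟨ ∣s∣≡k ⟩
    k                           ≡⟨ +-identityʳ k ⟨
    k + 0                       ∎)
    where open ≡-Reasoning

member : ∀ {n} (s : Subset n) → 0 < ∣ s ∣ → ∃ λ x → lookup s x ≡ true
member (true  ∷ s) _ = zero , refl
member (false ∷ s) p = let x , x∈s = member s p in suc x , x∈s

∣∖∣-lower-bound : ∀ {n} (s t : Subset n) m → ∣ s ∩ t ∣ + m ≤ ∣ s ∣ → m ≤ ∣ s ∩ ∁ t ∣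
∣∖∣-lower-bound s t m bound =
  +-cancelˡ-≤ ∣ s ∩ t ∣ m _ (subst (∣ s ∩ t ∣ + m ≤_) (∣s∣≡∣s∩t∣+∣s∩∁t∣ s t) bound)

∖-true : ∀ {n} (s t : Subset n) x → lookup (s ∩ ∁ t) x ≡ true → lookup s x ≡ true × lookup t x ≡ false
∖-true s t x x∈s∖t = let x∈s , x∈∁t = ∩-true s (∁ t) x x∈s∖t in x∈s , ∁-true⇒false t x x∈∁t

∖-member : ∀ {n} (s t : Subset n) → ∣ s ∩ t ∣ < ∣ s ∣ →
           Σ (Fin n) λ x → lookup s x ≡ true × lookup t x ≡ false
∖-member s t lt =
  let x , x∈s∖t = member (s ∩ ∁ t) (∣∖∣-lower-bound s t 1 (subst (_≤ ∣ s ∣) (+-comm 1 _) lt))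
  in x , ∖-true s t x x∈s∖t

module _ {n} (s : Subset n) (x : Fin n) where

  ∣[]≔false∣ : lookup s x ≡ true → suc ∣ s [ x ]≔ false ∣ ≡ ∣ s ∣
  ∣[]≔false∣ x∈s = trans (cong (λ b → toℕ b + ∣ s [ x ]≔ false ∣) (sym x∈s)) (∣[]≔∣ s x false)

  []≔false-≢ : ∀ y → lookup (s [ x ]≔ false) y ≡ true → y ≢ x
  []≔false-≢ y y∈ refl = true≢false y∈ (lookup∘update x s false)

  []≔false-⊆ : ∀ y → lookup (s [ x ]≔ false) y ≡ true → lookup s y ≡ true
  []≔false-⊆ y y∈ = trans (sym (lookup∘update′ ([]≔false-≢ y y∈) s false)) y∈

  []≔false-keeps : ∀ y → y ≢ x → lookup s y ≡ true → lookup (s [ x ]≔ false) y ≡ true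
  []≔false-keeps y y≢x y∈s = trans (lookup∘update′ y≢x s false) y∈s

two-members : ∀ {n} (s : Subset n) → 2 ≤ ∣ s ∣ →
              Σ (Fin n) λ x → Σ (Fin n) λ y → x ≢ y × lookup s x ≡ true × lookup s y ≡ true
two-members s 2≤∣s∣ = x , y , ([]≔false-≢ s x y y∈ ∘ sym) , x∈s , []≔false-⊆ s x y y∈
  where
  x∈ = member s (≤-trans (s≤s z≤n) 2≤∣s∣)
  x = proj₁ x∈
  x∈s = proj₂ x∈
  y∈s-x = member (s [ x ]≔ false) (≤-pred (subst (2 ≤_) (sym (∣[]≔false∣ s x x∈s)) 2≤∣s∣))
  y = proj₁ y∈s-x
  y∈ = proj₂ y∈s-x

record SubsetInjection {n} (P Q : Subset n) : Set where
  field
    map       : ∀ x → lookup P x ≡ true → Fin n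
    map∈      : ∀ x p → lookup Q (map x p) ≡ true
    injective : ∀ x y p q → map x p ≡ map y q → x ≡ y

module _ {n} {P Q : Subset n} (h : SubsetInjection P Q) where
  open SubsetInjection h

  removeFromInjection : ∀ x (p : lookup P x ≡ true) →
                        SubsetInjection (P [ x ]≔ false) (Q [ map x p ]≔ false)
  removeFromInjection x p = record
    { map       = λ y q → map y ([]≔false-⊆ P x y q)
    ; map∈      = λ y q → []≔false-keeps Q (map x p) _
                            (λ eq → []≔false-≢ P x y q (injective y x _ p eq)) (map∈ y _)
    ; injective = λ y z _ _ → injective y z _ _
    }

injection⇒∣∣≤ : ∀ {n} {P Q : Subset n} → SubsetInjection P Q → ∣ P ∣ ≤ ∣ Q ∣
injection⇒∣∣≤ {P = P} = go ∣ P ∣ refl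
  where
  go : ∀ {P Q : Subset _} m → ∣ P ∣ ≡ m → SubsetInjection P Q → ∣ P ∣ ≤ ∣ Q ∣
  go zero    ∣P∣≡0 h = subst (_≤ _) (sym ∣P∣≡0) z≤n
  go {P} {Q} (suc m) ∣P∣≡1+m h =
    subst₂ _≤_ (∣[]≔false∣ P x x∈P) (∣[]≔false∣ Q (map x x∈P) (map∈ x x∈P))
      (s≤s (go m (suc-injective (trans (∣[]≔false∣ P x x∈P) ∣P∣≡1+m)) (removeFromInjection h x x∈P)))
    where
    open SubsetInjection h
    x∈ = member P (subst (0 <_) (sym ∣P∣≡1+m) (s≤s z≤n))
    x = proj₁ x∈
    x∈P = proj₂ x∈

record FixedPointFreeInvolution {n} (S : Subset n) : Set where
  field
    map            : ∀ x → lookup S x ≡ true → Fin n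
    map∈           : ∀ x p → lookup S (map x p) ≡ true
    involutive     : ∀ x p q → map (map x p) q ≡ x
    no-fixed-point : ∀ x p → map x p ≢ x

  map-cong : ∀ {x y} p q → x ≡ y → map x p ≡ map y q
  map-cong p q refl = cong (map _) (bool-irrelevant p q)

module _ {n} {S : Subset n} (g : FixedPointFreeInvolution S) where
  open FixedPointFreeInvolution g

  removeOrbit : ∀ x (p : lookup S x ≡ true) →
                FixedPointFreeInvolution ((S [ x ]≔ false) [ map x p ]≔ false)
  removeOrbit x p = record
    { map            = λ z q → map z (inS z q)
    ; map∈           = λ z q → []≔false-keeps S₁ y _ (gz≢y z q)
                                 ([]≔false-keeps S x _ (gz≢x z q) (map∈ z _))
    ; involutive     = λ z q r → involutive z _ _
    ; no-fixed-point = λ z q → no-fixed-point z _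
    }
    where
    y = map x p
    S₁ = S [ x ]≔ false
    inS : ∀ z → lookup (S₁ [ y ]≔ false) z ≡ true → lookup S z ≡ true
    inS z q = []≔false-⊆ S x z ([]≔false-⊆ S₁ y z q)
    gz≢x : ∀ z q → map z (inS z q) ≢ x
    gz≢x z q gz≡x = []≔false-≢ S₁ y z q (begin
      z                        ≡⟨ involutive z _ (map∈ z _) ⟨
      map (map z _) (map∈ z _) ≡⟨ map-cong _ p gz≡x ⟩
      y                        ∎)
      where open ≡-Reasoning
    gz≢y : ∀ z q → map z (inS z q) ≢ y
    gz≢y z q gz≡y = []≔false-≢ S x z ([]≔false-⊆ S₁ y z q) (begin
      z                        ≡⟨ involutive z _ (map∈ z _) ⟨
      map (map z _) (map∈ z _) ≡⟨ map-cong _ (map∈ x p) gz≡y ⟩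
      map y (map∈ x p)         ≡⟨ involutive x p _ ⟩
      x                        ∎)
      where open ≡-Reasoning

remainingOrbits : ∀ {n} {S : Subset n} → FixedPointFreeInvolution S → 0 < ∣ S ∣ →
                  Σ (Subset n) λ S′ → FixedPointFreeInvolution S′ × 2 + ∣ S′ ∣ ≡ ∣ S ∣
remainingOrbits {S = S} g 0<∣S∣ = _ , removeOrbit g x x∈S , size
  where
  open FixedPointFreeInvolution g
  x = proj₁ (member S 0<∣S∣)
  x∈S = proj₂ (member S 0<∣S∣)
  y = map x x∈S
  size : 2 + ∣ (S [ x ]≔ false) [ y ]≔ false ∣ ≡ ∣ S ∣
  size = trans (cong suc (∣[]≔false∣ (S [ x ]≔ false) y
                   ([]≔false-keeps S x y (no-fixed-point x x∈S) (map∈ x x∈S))))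
               (∣[]≔false∣ S x x∈S)

fixed-point-free-involution⇒even : ∀ {n} {S : Subset n} → FixedPointFreeInvolution S → 2 ∣ ∣ S ∣
fixed-point-free-involution⇒even {S = S} g = go ∣ S ∣ refl g
  where
  nonempty : ∀ (S : Subset _) {m} → ∣ S ∣ ≡ suc m → 0 < ∣ S ∣
  nonempty S e = subst (0 <_) (sym e) (s≤s z≤n)
  go : ∀ {S : Subset _} m → ∣ S ∣ ≡ m → FixedPointFreeInvolution S → 2 ∣ ∣ S ∣
  go zero          ∣S∣≡0 g = divides 0 ∣S∣≡0
  go {S} (suc zero) ∣S∣≡1 g with remainingOrbits g (nonempty S ∣S∣≡1)
  ... | _ , _ , 2+∣S′∣≡∣S∣ with () ← suc-injective (trans 2+∣S′∣≡∣S∣ ∣S∣≡1)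
  go {S} (suc (suc m)) ∣S∣≡2+m g with remainingOrbits g (nonempty S ∣S∣≡2+m)
  ... | _ , g′ , 2+∣S′∣≡∣S∣ = subst (2 ∣_) 2+∣S′∣≡∣S∣
        (∣m∣n⇒∣m+n ∣-refl (go m (suc-injective (suc-injective (trans 2+∣S′∣≡∣S∣ ∣S∣≡2+m))) g′))

-- Rook's graphs

module _ {n : ℕ} where

  record Cell (R C : Subset n) : Set where
    constructor cell
    field
      row  : Fin n
      col  : Fin n
      row∈ : lookup R row ≡ true
      col∈ : lookup C col ≡ true

  open Cell public

  cell-≡ : ∀ {R C} {c d : Cell R C} → row c ≡ row d → col c ≡ col d → c ≡ d
  cell-≡ {c = cell a b p q} {cell .a .b p′ q′} refl refl =
    cong₂ (cell a b) (bool-irrelevant p p′) (bool-irrelevant q q′)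

  RookAdjacent : ∀ {R C} → Cell R C → Cell R C → Set
  RookAdjacent c d = (row c ≡ row d × col c ≢ col d) ⊎ (row c ≢ row d × col c ≡ col d)

  transpose : ∀ {R C} → Cell R C → Cell C R
  transpose (cell a b p q) = cell b a q p

  transpose-rook : ∀ {R C} (c d : Cell R C) → RookAdjacent c d → RookAdjacent (transpose c) (transpose d)
  transpose-rook _ _ (inj₁ (r , c)) = inj₂ (c , r)
  transpose-rook _ _ (inj₂ (r , c)) = inj₁ (c , r)

  record RookIso (R C R′ C′ : Subset n) : Set where
    field
      to        : Cell R C → Cell R′ C′
      from      : Cell R′ C′ → Cell R C
      from∘to   : ∀ c → from (to c) ≡ c
      to∘from   : ∀ d → to (from d) ≡ d
      to-rook   : ∀ c d → RookAdjacent c d → RookAdjacent (to c) (to d)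
      from-rook : ∀ c d → RookAdjacent c d → RookAdjacent (from c) (from d)

    to-injective : ∀ {c d} → to c ≡ to d → c ≡ d
    to-injective {c} {d} eq = trans (sym (from∘to c)) (trans (cong from eq) (from∘to d))

  inverse : ∀ {R C R′ C′} → RookIso R C R′ C′ → RookIso R′ C′ R C
  inverse g = record
    { to      = from    ; from    = to      ; to-rook   = from-rook
    ; from∘to = to∘from ; to∘from = from∘to ; from-rook = to-rook
    }
    where open RookIso g

  transposeIso : ∀ {R C R′ C′} → RookIso R C R′ C′ → RookIso C R C′ R′
  transposeIso g = record
    { to        = λ c → transpose (to (transpose c))
    ; from      = λ d → transpose (from (transpose d))
    ; from∘to   = λ c → cong transpose (from∘to (transpose c))
    ; to∘from   = λ d → cong transpose (to∘from (transpose d))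
    ; to-rook   = λ c d → transpose-rook (to (transpose c)) (to (transpose d))
                          ∘ to-rook _ _ ∘ transpose-rook c d
    ; from-rook = λ c d → transpose-rook (from (transpose c)) (from (transpose d))
                          ∘ from-rook _ _ ∘ transpose-rook c d
    }
    where open RookIso g

  module _ {R C R′ C′ : Subset n} (g : RookIso R C R′ C′) where
    open RookIso g

    row↦column⇒∣C∣≤∣R′∣ : (c d : Cell R C) → row c ≡ row d → col c ≢ col d →
                          col (to c) ≡ col (to d) → ∣ C ∣ ≤ ∣ R′ ∣
    row↦column⇒∣C∣≤∣R′∣ c d rc≡rd cc≢cd tc≡td = injection⇒∣∣≤ rowOfImage
      where
      inRow : ∀ b → lookup C b ≡ true → Cell R C
      inRow b b∈ = cell (row c) b (row∈ c) b∈
      -- any further cell of the row is rook-adjacent to both images, which share only their column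
      to-column : ∀ b b∈ → col (to (inRow b b∈)) ≡ col (to c)
      to-column b b∈ with b ≟ col c | b ≟ col d
      ... | yes b≡cc | _ = cong (col ∘ to) (cell-≡ refl b≡cc)
      ... | no _ | yes b≡cd = trans (cong (col ∘ to) (cell-≡ rc≡rd b≡cd)) (sym tc≡td)
      ... | no b≢cc | no b≢cd
          with to-rook _ c (inj₁ (refl , b≢cc)) | to-rook _ d (inj₁ (rc≡rd , b≢cd))
      ...   | inj₂ (_ , eq) | _ = eq
      ...   | inj₁ (_ , ≢c) | inj₂ (_ , eq) = ⊥-elim (≢c (trans eq (sym tc≡td)))
      ...   | inj₁ (r₁ , _) | inj₁ (r₂ , _) =
              ⊥-elim (cc≢cd (cong col (to-injective (cell-≡ (trans (sym r₁) r₂) tc≡td))))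
      rowOfImage : SubsetInjection C R′
      rowOfImage = record
        { map       = λ b b∈ → row (to (inRow b b∈))
        ; map∈      = λ b b∈ → row∈ (to (inRow b b∈))
        ; injective = λ b b′ b∈ b′∈ eq →
            cong col (to-injective (cell-≡ eq (trans (to-column b b∈) (sym (to-column b′ b′∈)))))
        }

  open RookIso

  rows↦rows : ∀ {R C R′ C′} → ∣ C ∣ ≢ ∣ R′ ∣ → (g : RookIso R C R′ C′) →
              ∀ c d → row c ≡ row d → row (to g c) ≡ row (to g d)
  rows↦rows ∣C∣≢∣R′∣ g c d rc≡rd with col c ≟ col d
  ... | yes cc≡cd = cong (row ∘ to g) (cell-≡ rc≡rd cc≡cd)
  ... | no cc≢cd with to-rook g c d (inj₁ (rc≡rd , cc≢cd))
  ...   | inj₁ (tc≡td , _) = tc≡td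
  ...   | inj₂ (tc≢td , tc≡td) = ⊥-elim (∣C∣≢∣R′∣ (≤-antisym
          (row↦column⇒∣C∣≤∣R′∣ g c d rc≡rd cc≢cd tc≡td)
          (row↦column⇒∣C∣≤∣R′∣ (transposeIso (inverse g)) (transpose (to g c)) (transpose (to g d))
             tc≡td tc≢td (trans (cong row (from∘to g c)) (trans rc≡rd (sym (cong row (from∘to g d))))))))

  cols↦cols : ∀ {R C R′ C′} → ∣ R ∣ ≢ ∣ C′ ∣ → (g : RookIso R C R′ C′) →
              ∀ c d → col c ≡ col d → col (to g c) ≡ col (to g d)
  cols↦cols ∣R∣≢∣C′∣ g c d = rows↦rows ∣R∣≢∣C′∣ (transposeIso g) (transpose c) (transpose d)

  rowInvolution : ∀ {R C} → ∣ C ∣ ≢ ∣ R ∣ → (g : RookIso R C R C) → (∀ c → to g (to g c) ≡ c) →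
                  (∀ c → ¬ RookAdjacent c (to g c)) → (c : Cell R C) → col (to g c) ≢ col c →
                  FixedPointFreeInvolution R
  rowInvolution {R} {C} ∣C∣≢∣R∣ g involutive no-rook-move c moved = record
    { map            = λ x x∈ → row (to g (inColumn x x∈))
    ; map∈           = λ x x∈ → row∈ (to g (inColumn x x∈))
    ; involutive     = λ x x∈ y∈ →
        trans (rows↦rows ∣C∣≢∣R∣ g (inColumn _ y∈) (to g (inColumn x x∈)) refl)
              (cong row (involutive (inColumn x x∈)))
    ; no-fixed-point = λ x x∈ fixed → no-rook-move (inColumn x x∈)
        (inj₁ (sym fixed , λ eq → moved (trans (sym (column-moves x x∈)) (sym eq))))
    }
    where
    inColumn : ∀ x → lookup R x ≡ true → Cell R C
    inColumn x x∈ = cell x (col c) x∈ (col∈ c)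
    column-moves : ∀ x x∈ → col (to g (inColumn x x∈)) ≡ col (to g c)
    column-moves x x∈ = cols↦cols (∣C∣≢∣R∣ ∘ sym) g (inColumn x x∈) c refl

  rook-involution-identity : ∀ {R C} → ∣ C ∣ ≢ ∣ R ∣ → ¬ ((2 ∣ ∣ R ∣) × (2 ∣ ∣ C ∣)) →
                             (g : RookIso R C R C) → (∀ c → to g (to g c) ≡ c) →
                             (∀ c → ¬ RookAdjacent c (to g c)) → ∀ c → to g c ≡ c
  rook-involution-identity ∣C∣≢∣R∣ not-both-even g involutive no-rook-move c
    with row (to g c) ≟ row c | col (to g c) ≟ col c
  ... | yes r | yes k = cell-≡ r k
  ... | yes r | no k  = ⊥-elim (no-rook-move c (inj₁ (sym r , k ∘ sym)))
  ... | no r  | yes k = ⊥-elim (no-rook-move c (inj₂ (r ∘ sym , sym k)))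
  ... | no r  | no k  = ⊥-elim (not-both-even
        ( fixed-point-free-involution⇒even (rowInvolution ∣C∣≢∣R∣ g involutive no-rook-move c k)
        , fixed-point-free-involution⇒even
            (rowInvolution (∣C∣≢∣R∣ ∘ sym) (transposeIso g) (cong transpose ∘ involutive ∘ transpose)
               (λ d → no-rook-move (transpose d) ∘ transpose-rook d (to (transposeIso g) d))
               (transpose c) r)))

-- Exchanges

Exchange : ∀ {n} → Subset n → Set
Exchange s = Cell s (∁ s)

module _ {n} (s : Subset n) where

  exchange : Exchange s → Subset n
  exchange e = (s [ row e ]≔ false) [ col e ]≔ true

  col∉ : (e : Exchange s) → lookup s (col e) ≡ false
  col∉ e = ∁-true⇒false s (col e) (col∈ e)

  row≢col : (e : Exchange s) → row e ≢ col e
  row≢col e eq = true≢false (row∈ e) (trans (cong (lookup s) eq) (col∉ e))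

  col∉removed : ∀ e → lookup (s [ row e ]≔ false) (col e) ≡ false
  col∉removed e = trans (lookup∘update′ (row≢col e ∘ sym) s false) (col∉ e)

  exchange-col : ∀ e → lookup (exchange e) (col e) ≡ true
  exchange-col e = lookup∘update (col e) (s [ row e ]≔ false) true

  exchange-row : ∀ e → lookup (exchange e) (row e) ≡ false
  exchange-row e =
    trans (lookup∘update′ (row≢col e) (s [ row e ]≔ false) true) (lookup∘update (row e) s false)

  exchange-other : ∀ e x → x ≢ row e → x ≢ col e → lookup (exchange e) x ≡ lookup s x
  exchange-other e x x≢r x≢c =
    trans (lookup∘update′ x≢c (s [ row e ]≔ false) true) (lookup∘update′ x≢r s false)

  ∣exchange-∩∣ : ∀ e t → toℕ (lookup t (row e)) + ∣ exchange e ∩ t ∣ ≡ toℕ (lookup t (col e)) + ∣ s ∩ t ∣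
  ∣exchange-∩∣ e t = begin
    ta + ∣ exchange e ∩ t ∣       ≡⟨ cong (ta +_) added ⟩
    ta + (tb + ∣ r ∩ t ∣)         ≡⟨ +-assoc ta tb _ ⟨
    (ta + tb) + ∣ r ∩ t ∣         ≡⟨ cong (_+ ∣ r ∩ t ∣) (+-comm ta tb) ⟩
    (tb + ta) + ∣ r ∩ t ∣         ≡⟨ +-assoc tb ta _ ⟩
    tb + (ta + ∣ r ∩ t ∣)         ≡⟨ cong (tb +_) removed ⟩
    tb + ∣ s ∩ t ∣                ∎
    where
    open ≡-Reasoning
    ta = toℕ (lookup t (row e))
    tb = toℕ (lookup t (col e))
    r = s [ row e ]≔ false
    added : ∣ exchange e ∩ t ∣ ≡ tb + ∣ r ∩ t ∣
    added = trans (cong (λ b → toℕ (b ∧ lookup t (col e)) + ∣ exchange e ∩ t ∣)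
                        (sym (col∉removed e)))
                  (trans (cong (λ b → toℕ b + ∣ exchange e ∩ t ∣) (sym (lookup-∩ r t (col e))))
                         (∣[]≔-∩∣ r t (col e) true))
    removed : ta + ∣ r ∩ t ∣ ≡ ∣ s ∩ t ∣
    removed = trans (cong (λ b → toℕ (b ∧ lookup t (row e)) + ∣ r ∩ t ∣) (sym (row∈ e)))
                    (trans (cong (λ b → toℕ b + ∣ r ∩ t ∣) (sym (lookup-∩ s t (row e))))
                           (∣[]≔-∩∣ s t (row e) false))

  ∣exchange∣ : ∀ e → ∣ exchange e ∣ ≡ ∣ s ∣
  ∣exchange∣ e = begin
    ∣ exchange e ∣                             ≡⟨ cong (λ b → toℕ b + ∣ exchange e ∣) (col∉removed e) ⟨
    toℕ (lookup r (col e)) + ∣ exchange e ∣    ≡⟨ ∣[]≔∣ r (col e) true ⟩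
    suc ∣ r ∣                                  ≡⟨ ∣[]≔false∣ s (row e) (row∈ e) ⟩
    ∣ s ∣                                      ∎
    where
    open ≡-Reasoning
    r = s [ row e ]≔ false

  1+∣exchange-∩-s∣ : ∀ e → suc ∣ exchange e ∩ s ∣ ≡ ∣ s ∣
  1+∣exchange-∩-s∣ e = begin
    toℕ true + ∣ exchange e ∩ s ∣                ≡⟨ cong (λ b → toℕ b + ∣ exchange e ∩ s ∣) (row∈ e) ⟨
    toℕ (lookup s (row e)) + ∣ exchange e ∩ s ∣  ≡⟨ ∣exchange-∩∣ e s ⟩
    toℕ (lookup s (col e)) + ∣ s ∩ s ∣           ≡⟨ cong₂ (λ b r → toℕ b + ∣ r ∣) (col∉ e) (∩-idem s) ⟩
    ∣ s ∣                                       ∎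
    where open ≡-Reasoning

  ∣∩∣≤1+∣exchange-∩∣ : ∀ e t → ∣ s ∩ t ∣ ≤ suc ∣ exchange e ∩ t ∣
  ∣∩∣≤1+∣exchange-∩∣ e t = begin
    ∣ s ∩ t ∣                                    ≤⟨ m≤n+m _ _ ⟩
    toℕ (lookup t (col e)) + ∣ s ∩ t ∣           ≡⟨ ∣exchange-∩∣ e t ⟨
    toℕ (lookup t (row e)) + ∣ exchange e ∩ t ∣  ≤⟨ +-monoˡ-≤ _ (toℕ≤1 (lookup t (row e))) ⟩
    suc ∣ exchange e ∩ t ∣                       ∎
    where
    open ≤-Reasoning
    toℕ≤1 : ∀ b → toℕ b ≤ 1
    toℕ≤1 true  = s≤s z≤n
    toℕ≤1 false = z≤n

  member≢nonmember : ∀ {x y} → lookup s x ≡ true → lookup s y ≡ false → x ≢ y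
  member≢nonmember x∈s y∉s refl = true≢false x∈s y∉s

  exchange-keeps : ∀ d x → lookup s x ≡ true → x ≢ row d → lookup (exchange d) x ≡ true
  exchange-keeps d x x∈s x≢r = trans (exchange-other d x x≢r (member≢nonmember x∈s (col∉ d))) x∈s

  exchange-omits : ∀ d x → lookup s x ≡ false → x ≢ col d → lookup (exchange d) x ≡ false
  exchange-omits d x x∉s x≢c = trans (exchange-other d x (member≢nonmember (row∈ d) x∉s ∘ sym) x≢c) x∉s

  exchange-injective : ∀ e d → exchange e ≡ exchange d → e ≡ d
  exchange-injective e d eq = cell-≡ same-row same-col
    where
    same-row : row e ≡ row d
    same-row with row e ≟ row d
    ... | yes r = r
    ... | no r  = ⊥-elim (true≢false (exchange-keeps d (row e) (row∈ e) r)
                                     (trans (cong (λ t → lookup t (row e)) (sym eq)) (exchange-row e)))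
    same-col : col e ≡ col d
    same-col with col e ≟ col d
    ... | yes c = c
    ... | no c  = ⊥-elim (true≢false (trans (cong (λ t → lookup t (col e)) (sym eq)) (exchange-col e))
                                     (exchange-omits d (col e) (col∉ e) c))

  exchange-agrees⇔rook : ∀ e d →
    lookup (exchange d) (row e) ≡ lookup (exchange d) (col e) ⇔ RookAdjacent e d
  exchange-agrees⇔rook e d = mk⇔ to from
    where
    to : lookup (exchange d) (row e) ≡ lookup (exchange d) (col e) → RookAdjacent e d
    to agree with row e ≟ row d | col e ≟ col d
    ... | yes r | yes c = ⊥-elim (true≢false
            (trans (cong (lookup (exchange d)) c) (exchange-col d))
            (trans (sym agree) (trans (cong (lookup (exchange d)) r) (exchange-row d))))
    ... | yes r | no c  = inj₁ (r , c)
    ... | no r  | yes c = inj₂ (r , c)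
    ... | no r  | no c  = ⊥-elim (true≢false
            (trans (sym agree) (exchange-keeps d (row e) (row∈ e) r))
            (exchange-omits d (col e) (col∉ e) c))
    from : RookAdjacent e d → lookup (exchange d) (row e) ≡ lookup (exchange d) (col e)
    from (inj₁ (r , c)) = trans (trans (cong (lookup (exchange d)) r) (exchange-row d))
                                (sym (exchange-omits d (col e) (col∉ e) c))
    from (inj₂ (r , c)) = trans (exchange-keeps d (row e) (row∈ e) r)
                                (sym (trans (cong (lookup (exchange d)) c) (exchange-col d)))

  exchanges-adjacent⇔rook : ∀ e d → suc ∣ exchange e ∩ exchange d ∣ ≡ ∣ s ∣ ⇔ RookAdjacent e d
  exchanges-adjacent⇔rook e d =
    exchange-agrees⇔rook e d ⇔-∘ (toℕ-balance (∣exchange-∩∣ e t) ⇔-∘ adjacent⇔balanced)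
    where
    t = exchange d
    1+∣s∩t∣ : suc ∣ s ∩ t ∣ ≡ ∣ s ∣
    1+∣s∩t∣ = trans (cong (suc ∘ ∣_∣) (∩-comm s t)) (1+∣exchange-∩-s∣ d)
    adjacent⇔balanced : suc ∣ exchange e ∩ t ∣ ≡ ∣ s ∣ ⇔ ∣ exchange e ∩ t ∣ ≡ ∣ s ∩ t ∣
    adjacent⇔balanced = mk⇔ (λ adj → suc-injective (trans adj (sym 1+∣s∩t∣)))
                            (λ balanced → trans (cong suc balanced) 1+∣s∩t∣)

  ∣exchange-∩∣-gain : ∀ e t → lookup t (row e) ≡ false → lookup t (col e) ≡ true →
                      ∣ exchange e ∩ t ∣ ≡ suc ∣ s ∩ t ∣
  ∣exchange-∩∣-gain e t row∉t col∈t = begin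
    ∣ exchange e ∩ t ∣                            ≡⟨ cong (λ b → toℕ b + ∣ exchange e ∩ t ∣) row∉t ⟨
    toℕ (lookup t (row e)) + ∣ exchange e ∩ t ∣   ≡⟨ ∣exchange-∩∣ e t ⟩
    toℕ (lookup t (col e)) + ∣ s ∩ t ∣            ≡⟨ cong (λ b → toℕ b + ∣ s ∩ t ∣) col∈t ⟩
    suc ∣ s ∩ t ∣                                 ∎
    where open ≡-Reasoning

  ∣exchange-∩∣-no-loss : ∀ e t → lookup t (row e) ≡ false → ∣ s ∩ t ∣ ≤ ∣ exchange e ∩ t ∣
  ∣exchange-∩∣-no-loss e t row∉t = begin
    ∣ s ∩ t ∣                                     ≤⟨ m≤n+m _ _ ⟩
    toℕ (lookup t (col e)) + ∣ s ∩ t ∣            ≡⟨ ∣exchange-∩∣ e t ⟨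
    toℕ (lookup t (row e)) + ∣ exchange e ∩ t ∣   ≡⟨ cong (λ b → toℕ b + ∣ exchange e ∩ t ∣) row∉t ⟩
    ∣ exchange e ∩ t ∣                            ∎
    where open ≤-Reasoning

  exchange-toward : ∀ t → ∣ t ∣ ≡ ∣ s ∣ → ∣ s ∩ t ∣ < ∣ s ∣ →
                    Σ (Exchange s) λ e → ∣ exchange e ∩ t ∣ ≡ suc ∣ s ∩ t ∣
  exchange-toward t ∣t∣≡∣s∣ ∣s∩t∣<∣s∣ =
    let a , a∈s , a∉t = ∖-member s t ∣s∩t∣<∣s∣
        b , b∈t , b∉s = ∖-member t s (subst₂ _<_ (cong ∣_∣ (∩-comm s t)) (sym ∣t∣≡∣s∣) ∣s∩t∣<∣s∣)
        e = cell a b a∈s (false⇒∁-true s b b∉s)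
    in e , ∣exchange-∩∣-gain e t a∉t b∈t

  adjacent⇒exchange : ∀ t → ∣ t ∣ ≡ ∣ s ∣ → suc ∣ s ∩ t ∣ ≡ ∣ s ∣ → Σ (Exchange s) λ e → exchange e ≡ t
  adjacent⇒exchange t ∣t∣≡∣s∣ adj =
    let e , ∣e∩t∣≡1+∣s∩t∣ = exchange-toward t ∣t∣≡∣s∣ (subst (∣ s ∩ t ∣ <_) adj (n<1+n _))
    in e , ∣∩∣≡size⇒≡ (exchange e) t (∣exchange∣ e) ∣t∣≡∣s∣ (trans ∣e∩t∣≡1+∣s∩t∣ adj)

-- The Johnson graph

module _ {n k : ℕ} where

  ⌊_⌋ : Vertex n k → Subset n
  ⌊_⌋ = proj₁

  shared : Vertex n k → Vertex n k → ℕ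
  shared u v = ∣ ⌊ u ⌋ ∩ ⌊ v ⌋ ∣

  ≈V⇒≡ : {u v : Vertex n k} → u ≈V v → u ≡ v
  ≈V⇒≡ {s , p} {.s , q} refl = cong (s ,_) (≡-irrelevant p q)

  shared-comm : ∀ u v → shared u v ≡ shared v u
  shared-comm u v = cong ∣_∣ (∩-comm ⌊ u ⌋ ⌊ v ⌋)

  shared-self : ∀ u → shared u u ≡ k
  shared-self u = trans (cong ∣_∣ (∩-idem ⌊ u ⌋)) (proj₂ u)

  shared≤k : ∀ u v → shared u v ≤ k
  shared≤k u v = subst (shared u v ≤_) (proj₂ u) (∣p∩q∣≤∣p∣ ⌊ u ⌋ ⌊ v ⌋)

  shared≡k⇒≡ : ∀ u v → shared u v ≡ k → u ≡ v
  shared≡k⇒≡ u v = ≈V⇒≡ ∘ ∣∩∣≡size⇒≡ ⌊ u ⌋ ⌊ v ⌋ (proj₂ u) (proj₂ v)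

  adjacent-sym : ∀ (u v : Vertex n k) → Adjacent u v → Adjacent v u
  adjacent-sym u v adj = trans (cong suc (shared-comm v u)) adj

  neighbour : (u : Vertex n k) → Exchange ⌊ u ⌋ → Vertex n k
  neighbour u e = exchange ⌊ u ⌋ e , trans (∣exchange∣ ⌊ u ⌋ e) (proj₂ u)

  neighbour-adjacent : ∀ u e → Adjacent (neighbour u e) u
  neighbour-adjacent u e = trans (1+∣exchange-∩-s∣ ⌊ u ⌋ e) (proj₂ u)

  neighbour-injective : ∀ u e d → neighbour u e ≡ neighbour u d → e ≡ d
  neighbour-injective u e d = exchange-injective ⌊ u ⌋ e d ∘ cong ⌊_⌋

  adjacent⇒neighbour : ∀ u w → Adjacent u w → Σ (Exchange ⌊ u ⌋) λ e → w ≡ neighbour u e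
  adjacent⇒neighbour u w adj =
    let e , eq = adjacent⇒exchange ⌊ u ⌋ ⌊ w ⌋ (trans (proj₂ w) (sym (proj₂ u)))
                                               (trans adj (sym (proj₂ u)))
    in e , ≈V⇒≡ (sym eq)

  neighbours-adjacent⇔rook : ∀ u e d → Adjacent (neighbour u e) (neighbour u d) ⇔ RookAdjacent e d
  neighbours-adjacent⇔rook u e d = mk⇔
    (λ adj → Equivalence.to rook⇔ (trans adj (sym (proj₂ u))))
    (λ rook → trans (Equivalence.from rook⇔ rook) (proj₂ u))
    where rook⇔ = exchanges-adjacent⇔rook ⌊ u ⌋ e d

  shared-toward : ∀ x y → shared x y < k →
                  Σ (Exchange ⌊ x ⌋) λ e → shared (neighbour x e) y ≡ suc (shared x y)
  shared-toward x y lt = exchange-toward ⌊ x ⌋ ⌊ y ⌋ (trans (proj₂ y) (sym (proj₂ x)))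
                                                   (subst (shared x y <_) (sym (proj₂ x)) lt)

  adjacent⇒shared≤1+ : ∀ x w y → Adjacent x w → shared x y ≤ suc (shared w y)
  adjacent⇒shared≤1+ x w y adj =
    let e , w≡x′ = adjacent⇒neighbour x w adj
    in subst (λ v → shared x y ≤ suc (shared v y)) (sym w≡x′) (∣∩∣≤1+∣exchange-∩∣ ⌊ x ⌋ e ⌊ y ⌋)

  private
    closer : ∀ x y {m} → shared x y + suc m ≡ k → shared x y < k
    closer x y eq = subst (shared x y <_) eq (m<m+n _ (s≤s z≤n))

    step-closer : ∀ x y {m} e → shared (neighbour x e) y ≡ suc (shared x y) →
                  shared x y + suc m ≡ k → shared (neighbour x e) y + m ≡ k
    step-closer x y {m} e eq d = trans (cong (_+ m) eq) (trans (sym (+-suc _ m)) d)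

    start : ∀ x y → shared x y + (k ∸ shared x y) ≡ k
    start x y = m+[n∸m]≡n (shared≤k x y)

  connected : (P : Vertex n k → Set) → (∀ x w → Adjacent x w → P w → P x) →
              ∀ y → P y → ∀ x → P x
  connected P closed y Py x = go (k ∸ shared x y) x (start x y)
    where
    go : ∀ m x → shared x y + m ≡ k → P x
    go zero    x d = subst P (sym (shared≡k⇒≡ x y (trans (sym (+-identityʳ _)) d))) Py
    go (suc m) x d =
      let e , nearer = shared-toward x y (closer x y d)
          x′ = neighbour x e
      in closed x x′ (adjacent-sym x′ x (neighbour-adjacent x e)) (go m x′ (step-closer x y e nearer d))

  shared-nondecreasing : (f : Vertex n k → Vertex n k) → (∀ u v → Adjacent u v → Adjacent (f u) (f v)) →
                         ∀ x y → shared x y ≤ shared (f x) (f y)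
  shared-nondecreasing f preserves x y = go (k ∸ shared x y) x (start x y)
    where
    go : ∀ m x → shared x y + m ≡ k → shared x y ≤ shared (f x) (f y)
    go zero x d = ≤-trans (shared≤k x y) (≤-reflexive (trans (sym (shared-self (f x)))
                    (cong (shared (f x) ∘ f) (shared≡k⇒≡ x y (trans (sym (+-identityʳ _)) d)))))
    go (suc m) x d =
      let e , nearer = shared-toward x y (closer x y d)
          x′ = neighbour x e
      in ≤-pred (begin
        suc (shared x y)            ≡⟨ nearer ⟨
        shared x′ y                 ≤⟨ go m x′ (step-closer x y e nearer d) ⟩
        shared (f x′) (f y)         ≤⟨ adjacent⇒shared≤1+ (f x′) (f x) (f y)
                                         (preserves x′ x (neighbour-adjacent x e)) ⟩
        suc (shared (f x) (f y))    ∎)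
      where open ≤-Reasoning

-- Automorphisms

module _ {n k : ℕ} (φ : Automorphism n k) where
  open Automorphism φ

  preserves : ∀ u v → Adjacent u v → Adjacent (fun u) (fun v)
  preserves u v = proj₁ (adj-iff u v)

  opaque
    image-neighbour : ∀ u v → fun u ≡ v → (e : Exchange ⌊ u ⌋) →
                      Σ (Exchange ⌊ v ⌋) λ e′ → fun (neighbour u e) ≡ neighbour v e′
    image-neighbour u v fu≡v e = adjacent⇒neighbour v (fun (neighbour u e))
      (adjacent-sym (fun (neighbour u e)) v
        (subst (Adjacent (fun (neighbour u e))) fu≡v (preserves _ u (neighbour-adjacent u e))))

  image : ∀ u v → fun u ≡ v → Exchange ⌊ u ⌋ → Exchange ⌊ v ⌋
  image u v fu≡v e = proj₁ (image-neighbour u v fu≡v e)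

  fun-neighbour : ∀ u v fu≡v e → fun (neighbour u e) ≡ neighbour v (image u v fu≡v e)
  fun-neighbour u v fu≡v e = proj₂ (image-neighbour u v fu≡v e)

  image-rook : ∀ u v fu≡v e d → RookAdjacent e d → RookAdjacent (image u v fu≡v e) (image u v fu≡v d)
  image-rook u v fu≡v e d rook =
    Equivalence.to (neighbours-adjacent⇔rook v (image u v fu≡v e) (image u v fu≡v d))
    (subst₂ Adjacent (fun-neighbour u v fu≡v e) (fun-neighbour u v fu≡v d)
      (preserves _ _ (Equivalence.from (neighbours-adjacent⇔rook u e d) rook)))

module _ {n k : ℕ} (φ : Automorphism n k)
         (involutive : ∀ u → Automorphism.fun φ (Automorphism.fun φ u) ≈V u) where
  open Automorphism φ

  fun∘fun : ∀ u → fun (fun u) ≡ u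
  fun∘fun u = ≈V⇒≡ (involutive u)

  image-involutive : ∀ u v fu≡v fv≡u e → image φ v u fv≡u (image φ u v fu≡v e) ≡ e
  image-involutive u v fu≡v fv≡u e = neighbour-injective u e′′ e (begin
    neighbour u e′′             ≡⟨ fun-neighbour φ v u fv≡u e′ ⟨
    fun (neighbour v e′)        ≡⟨ cong fun (fun-neighbour φ u v fu≡v e) ⟨
    fun (fun (neighbour u e))   ≡⟨ fun∘fun (neighbour u e) ⟩
    neighbour u e               ∎)
    where
    open ≡-Reasoning
    e′ = image φ u v fu≡v e
    e′′ = image φ v u fv≡u e′

  localIso : ∀ u v → fun u ≡ v → RookIso ⌊ u ⌋ (∁ ⌊ u ⌋) ⌊ v ⌋ (∁ ⌊ v ⌋)
  localIso u v fu≡v = record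
    { to        = image φ u v fu≡v
    ; from      = image φ v u fv≡u
    ; from∘to   = image-involutive u v fu≡v fv≡u
    ; to∘from   = image-involutive v u fv≡u fu≡v
    ; to-rook   = image-rook φ u v fu≡v
    ; from-rook = image-rook φ v u fv≡u
    }
    where
    fv≡u : fun v ≡ u
    fv≡u = trans (cong fun (sym fu≡v)) (fun∘fun u)

  shared-preserved : ∀ x y → shared (fun x) (fun y) ≡ shared x y
  shared-preserved x y = ≤-antisym
    (subst₂ (λ a b → shared (fun x) (fun y) ≤ shared a b) (fun∘fun x) (fun∘fun y)
       (shared-nondecreasing fun (preserves φ) (fun x) (fun y)))
    (shared-nondecreasing fun (preserves φ) x y)

module NonAdjacentInvolution {n k : ℕ} (φ : Automorphism n k)
         (involutive : ∀ u → Automorphism.fun φ (Automorphism.fun φ u) ≈V u)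
         (no-adjacent-image : ∀ u → ¬ Adjacent u (Automorphism.fun φ u))
         (n≢2k : n ≢ 2 * k) (n-or-k-odd : n % 2 ≡ 1 ⊎ k % 2 ≡ 1) where
  open Automorphism φ

  ∣∁∣≢∣∣ : ∀ (u v : Vertex n k) → ∣ ∁ ⌊ u ⌋ ∣ ≢ ∣ ⌊ v ⌋ ∣
  ∣∁∣≢∣∣ u v eq = n≢2k (begin
    n                            ≡⟨ ∣s∣+∣∁s∣≡n ⌊ u ⌋ ⟨
    ∣ ⌊ u ⌋ ∣ + ∣ ∁ ⌊ u ⌋ ∣      ≡⟨ cong₂ _+_ (proj₂ u) (trans eq (proj₂ v)) ⟩
    k + k                        ≡⟨ cong (k +_) (+-identityʳ k) ⟨
    2 * k                        ∎)
    where open ≡-Reasoning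

  not-both-even : ∀ (u : Vertex n k) → ¬ ((2 ∣ ∣ ⌊ u ⌋ ∣) × (2 ∣ ∣ ∁ ⌊ u ⌋ ∣))
  not-both-even u (2∣∣u∣ , 2∣∣∁u∣) = [ even-odd n 2∣n , even-odd k 2∣k ] n-or-k-odd
    where
    even-odd : ∀ m → 2 ∣ m → m % 2 ≢ 1
    even-odd m 2∣m m-odd = 0≢1+n (trans (sym (n∣m⇒m%n≡0 m 2 2∣m)) m-odd)
    2∣n = subst (2 ∣_) (∣s∣+∣∁s∣≡n ⌊ u ⌋) (∣m∣n⇒∣m+n 2∣∣u∣ 2∣∣∁u∣)
    2∣k = subst (2 ∣_) (proj₂ u) 2∣∣u∣

  fixed⇒neighbours-fixed : ∀ u → fun u ≡ u → ∀ e → fun (neighbour u e) ≡ neighbour u e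
  fixed⇒neighbours-fixed u fu≡u e =
    trans (fun-neighbour φ u u fu≡u e) (cong (neighbour u) (image-fixed e))
    where
    no-rook-move : ∀ d → ¬ RookAdjacent d (image φ u u fu≡u d)
    no-rook-move d rook = no-adjacent-image (neighbour u d)
      (subst (Adjacent (neighbour u d)) (sym (fun-neighbour φ u u fu≡u d))
        (Equivalence.from (neighbours-adjacent⇔rook u d (image φ u u fu≡u d)) rook))
    image-fixed : ∀ d → image φ u u fu≡u d ≡ d
    image-fixed = rook-involution-identity (∣∁∣≢∣∣ u u) (not-both-even u)
                    (localIso φ involutive u u fu≡u)
                    (image-involutive φ involutive u u fu≡u fu≡u) no-rook-move

  fixed⇒all-fixed : ∀ z → fun z ≡ z → ∀ x → fun x ≡ x
  fixed⇒all-fixed = connected (λ x → fun x ≡ x) fixed-step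
    where
    fixed-step : ∀ x w → Adjacent x w → fun w ≡ w → fun x ≡ x
    fixed-step x w adj fw≡w =
      let e , x≡ = adjacent⇒neighbour w x (adjacent-sym x w adj)
      in subst (λ v → fun v ≡ v) (sym x≡) (fixed⇒neighbours-fixed w fw≡w e)

  shared-increases : ∀ u (e : Exchange ⌊ u ⌋) →
                     lookup ⌊ fun u ⌋ (row e) ≡ false → lookup ⌊ fun u ⌋ (col e) ≡ true →
                     col (image φ u (fun u) refl e) ≢ row e →
                     shared u (fun u) < shared (neighbour u e) (fun (neighbour u e))
  shared-increases u e row∉fu col∈fu moved = begin-strict
    shared u (fun u)               <⟨ n<1+n _ ⟩
    suc (shared u (fun u))         ≡⟨ ∣exchange-∩∣-gain ⌊ u ⌋ e ⌊ fun u ⌋ row∉fu col∈fu ⟨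
    shared w (fun u)               ≡⟨ shared-preserved φ involutive w (fun u) ⟨
    shared (fun w) (fun (fun u))   ≡⟨ cong (shared (fun w)) (fun∘fun φ involutive u) ⟩
    shared (fun w) u               ≡⟨ shared-comm (fun w) u ⟩
    shared u (fun w)               ≤⟨ ∣exchange-∩∣-no-loss ⌊ u ⌋ e ⌊ fun w ⌋ row∉fw ⟩
    shared w (fun w)               ∎
    where
    open ≤-Reasoning
    w = neighbour u e
    row∉fw : lookup ⌊ fun w ⌋ (row e) ≡ false
    row∉fw = subst (λ v → lookup ⌊ v ⌋ (row e) ≡ false) (sym (fun-neighbour φ u (fun u) refl e))
               (exchange-omits ⌊ fun u ⌋ (image φ u (fun u) refl e) (row e) row∉fu (moved ∘ sym))

  -- Two exchanges in one row have images in one row (n ≠ 2k), hence in different columns,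
  -- so at least one image does not put back the removed element.
  improving-neighbour : ∀ u (e₁ e₂ : Exchange ⌊ u ⌋) → row e₁ ≡ row e₂ → col e₁ ≢ col e₂ →
                        lookup ⌊ fun u ⌋ (row e₁) ≡ false → lookup ⌊ fun u ⌋ (col e₁) ≡ true →
                        lookup ⌊ fun u ⌋ (col e₂) ≡ true →
                        Σ (Vertex n k) λ w → shared u (fun u) < shared w (fun w)
  improving-neighbour u e₁ e₂ same-row cols-differ r∉fu c₁∈fu c₂∈fu
    with col (image φ u (fun u) refl e₁) ≟ row e₁
  ... | no moved₁ = neighbour u e₁ , shared-increases u e₁ r∉fu c₁∈fu moved₁
  ... | yes c₁≡r = neighbour u e₂ ,
        shared-increases u e₂ (subst (λ x → lookup ⌊ fun u ⌋ x ≡ false) same-row r∉fu) c₂∈fu moved₂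
    where
    open RookIso
    g = localIso φ involutive u (fun u) refl
    moved₂ : col (to g e₂) ≢ row e₂
    moved₂ c₂≡r = cols-differ (cong col (to-injective g (cell-≡
      (rows↦rows (∣∁∣≢∣∣ u (fun u)) g e₁ e₂ same-row) (trans c₁≡r (trans same-row (sym c₂≡r))))))

  shared-improvable : ∀ u → shared u (fun u) + 2 ≤ k →
                      Σ (Vertex n k) λ w → shared u (fun u) < shared w (fun w)
  shared-improvable u room
    with ∖-member ⌊ u ⌋ ⌊ fun u ⌋ u∖fu-nonempty | two-members (⌊ fun u ⌋ ∩ ∁ ⌊ u ⌋) fu∖u-has-two
    where
    u∖fu-nonempty : ∣ ⌊ u ⌋ ∩ ⌊ fun u ⌋ ∣ < ∣ ⌊ u ⌋ ∣
    u∖fu-nonempty = subst (shared u (fun u) <_) (sym (proj₂ u)) (<-≤-trans (m<m+n _ (s≤s z≤n)) room)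
    fu∖u-has-two : 2 ≤ ∣ ⌊ fun u ⌋ ∩ ∁ ⌊ u ⌋ ∣
    fu∖u-has-two = ∣∖∣-lower-bound ⌊ fun u ⌋ ⌊ u ⌋ 2
      (subst₂ (λ x y → x + 2 ≤ y) (shared-comm u (fun u)) (sym (proj₂ (fun u))) room)
  ... | a , a∈u , a∉fu | b₁ , b₂ , b₁≢b₂ , b₁∈fu∖u , b₂∈fu∖u =
    let b₁∈fu , b₁∈∁u = ∩-true ⌊ fun u ⌋ (∁ ⌊ u ⌋) b₁ b₁∈fu∖u
        b₂∈fu , b₂∈∁u = ∩-true ⌊ fun u ⌋ (∁ ⌊ u ⌋) b₂ b₂∈fu∖u
    in improving-neighbour u (cell a b₁ a∈u b₁∈∁u) (cell a b₂ a∈u b₂∈∁u) refl b₁≢b₂ a∉fu b₁∈fu b₂∈fu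


  fixed-vertex : Vertex n k → Σ (Vertex n k) λ z → fun z ≡ z
  fixed-vertex u = search (k ∸ shared u (fun u)) u ≤-refl
    where
    search : ∀ N u → k ∸ shared u (fun u) ≤ N → Σ (Vertex n k) λ z → fun z ≡ z
    search N u gap≤N with ≤⇒≡⊎1+≡⊎2+≤ (shared≤k u (fun u))
    ... | inj₁ full             = u , sym (shared≡k⇒≡ u (fun u) full)
    ... | inj₂ (inj₁ adjacent)  = ⊥-elim (no-adjacent-image u adjacent)
    ... | inj₂ (inj₂ room) with shared-improvable u room | N
    ...   | w , better | zero   = ⊥-elim (<⇒≱ (m<n⇒0<n∸m (<-≤-trans better (shared≤k w (fun w)))) gap≤N)
    ...   | w , better | suc N′ =
            search N′ w (≤-pred (<-≤-trans (∸-monoʳ-< better (shared≤k w (fun w))) gap≤N))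

proposition3p5 : (n k : ℕ) → k ≤ n → ¬ (n ≡ 2 * k) → (n % 2 ≡ 1 ⊎ k % 2 ≡ 1) →
    (φ : Automorphism n k) →
    (∀ u → Automorphism.fun φ (Automorphism.fun φ u) ≈V u) →
    (∀ u → ¬ Adjacent u (Automorphism.fun φ u)) →
    ∀ u → Automorphism.fun φ u ≈V u
proposition3p5 n k _ n≢2k n-or-k-odd φ involutive no-adjacent-image u =
  let z , fz≡z = fixed-vertex u in cong ⌊_⌋ (fixed⇒all-fixed z fz≡z u)
  where open NonAdjacentInvolution φ involutive no-adjacent-image n≢2k n-or-k-odd
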